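{- For $r \ge 3$ let $P_r$ be the probability that $p_1p_2\cdots p_r$ is 2-Korselt, where $p_1,\dots,p_r$ are independent random elements of $\mathbb{Z}_2^*$ distributed according to normalized Haar measure. Then $P_r = \Omega(r^{ -1})$ as $r \to \infty$, i.e. there exist $c>0$ and $r_0$ such that $P_r \ge c/r$ for all $r \ge r_0$.
   Context: $\mathbb{Z}_2^*$ is the group of units (odd elements) of the 2-adic integers; Haar measure corresponds to the binary digits above the units digit being independent fair coin flips. The product $p_1\cdots p_r$ is called 2-Korselt if $\nu_2(p_1\cdots p_r - 1) \ge \max_i \nu_2(p_i - 1)$, where $\nu_2$ is the 2-adic valuation. -}

module Defs where

open import Data.Nat using (ℕ; zero; suc; _+_; _*_; _∸_; _^_; _≤_; _≤?_; _⊔_)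
open import Data.Nat.DivMod using (_%_; _/_)
open import Data.List using (List; []; _∷_; map; concatMap; filter; length; foldr; upTo)
open import Data.Nat.ListAction using (product)
open import Data.Nat.Properties using (m^n≢0)

-- Units of ℤ/2^(suc k): the odd residues 1 + 2j, 0 ≤ j < 2^k.
unitsMod : ℕ → List ℕ
unitsMod k = map (λ j → 1 + 2 * j) (upTo (2 ^ k))

tuples : ℕ → ℕ → List (List ℕ)
tuples k zero    = [] ∷ []
tuples k (suc r) = concatMap (λ x → map (x ∷_) (tuples k r)) (unitsMod k)

-- Truncated 2-adic valuation: tv m n = min (ν₂ n , m), with ν₂ 0 = ∞.
tv : ℕ → ℕ → ℕ
tv zero    n = 0
tv (suc m) n with n % 2
... | zero  = suc (tv m (n / 2))
... | suc _ = 0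

tv1 : ℕ → ℕ → ℕ
tv1 m x = tv m (x ∸ 1)

-- Level-m truncation of the 2-Korselt condition for residues mod 2^m:
--   min (max_i ν₂(p_i - 1), m) ≤ min (ν₂(p_1⋯p_r - 1), m)
maxVal : ℕ → List ℕ → ℕ
maxVal m xs = foldr (λ x acc → tv1 m x ⊔ acc) 0 xs

prodVal : ℕ → List ℕ → ℕ
prodVal m xs = tv1 m (_%_ (product xs) (2 ^ m) {{m^n≢0 2 m}})

-- Its Haar probability is
--   korseltCount k r / 2^(k*r),
-- and P_r is the (decreasing) limit / infimum of these over k.
korseltCount : ℕ → ℕ → ℕ
korseltCount k r =
  length (filter (λ xs → maxVal (suc k) xs ≤? prodVal (suc k) xs) (tuples k r))

{-# OPTIONS --safe #-}

-- Fix L with 2r ≤ 2^L ≤ 4r.  If ν₂(p_i − 1) ≤ L for all i and p_1⋯p_r ≡ 1 (mod 2^L),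
-- then max_i ν₂(p_i − 1) ≤ L ≤ ν₂(p_1⋯p_r − 1), so the product is 2-Korselt.  Such tuples
-- arise by taking p_1, …, p_(r−1) among the units with ν₂(p − 1) ≤ L (a proportion
-- 1 − 2^(−L)) and p_r in the class of (p_1⋯p_(r−1))^(−1) mod 2^L (it exists by Hensel
-- lifting) but not ≡ 1 mod 2^(L+1) (a proportion 2^(−L)).  By Bernoulli's inequality
-- (1 − 2^(−L))^(r−1) ≥ 1/2 since 2^L ≥ 2r, so the proportion of 2-Korselt tuples is at
-- least 2^(−L)/2 ≥ 1/(8r).  When the residues are only known mod 2^(k+1) with k ≤ L, every
-- unit qualifies and one asks for p_1⋯p_r ≡ 1 (mod 2^(k+1)) instead: a proportion
-- 2^(−k) ≥ 1/(4r).

module Submission where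

open import Level using (0ℓ)
open import Data.Nat
open import Data.Nat.Properties
open import Data.Nat.DivMod
open import Data.Nat.Divisibility
open import Data.Nat.ListAction using (product)
open import Data.Nat.Tactic.RingSolver using (solve-∀)
open import Data.List using (List; []; _∷_; [_]; map; concatMap; filter; length; applyUpTo; _++_)
open import Data.List.Properties
  using (length-++; filter-++; filter-all; filter-some; map-id; length-applyUpTo; map-upTo)
open import Data.List.Relation.Unary.All using (All; []; _∷_; all?)
open import Data.List.Relation.Unary.All.Properties using (applyUpTo⁺₁)
open import Data.List.Relation.Unary.Any using (here)
open import Data.List.Relation.Unary.Any.Properties using (applyUpTo⁺)
open import Data.Product using (Σ; _,_; _×_)
open import Data.Sum using (_⊎_; inj₁; inj₂)
open import Data.Empty using (⊥-elim)
open import Function using (_∘_; id)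
open import Relation.Binary.PropositionalEquality hiding ([_])
open import Relation.Nullary using (yes; no; ¬_)
open import Relation.Nullary.Decidable using (_×-dec_)
open import Relation.Unary using (Pred; Decidable)

open import Defs

count : {A : Set} {P : Pred A 0ℓ} → Decidable P → List A → ℕ
count P? xs = length (filter P? xs)

applyUpTo-cong : {A : Set} {f g : ℕ → A} → f ≗ g → ∀ n → applyUpTo f n ≡ applyUpTo g n
applyUpTo-cong f≗g zero    = refl
applyUpTo-cong f≗g (suc n) = cong₂ _∷_ (f≗g 0) (applyUpTo-cong (f≗g ∘ suc) n)

applyUpTo-+ : {A : Set} (f : ℕ → A) (m n : ℕ) →
              applyUpTo f (m + n) ≡ applyUpTo f m ++ applyUpTo (λ j → f (m + j)) n
applyUpTo-+ f zero    n = refl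
applyUpTo-+ f (suc m) n = cong (f 0 ∷_) (applyUpTo-+ (f ∘ suc) m n)

module _ {A : Set} {P : Pred A 0ℓ} (P? : Decidable P) where

  count-++ : ∀ xs ys → count P? (xs ++ ys) ≡ count P? xs + count P? ys
  count-++ xs ys = trans (cong length (filter-++ P? xs ys)) (length-++ (filter P? xs))

  count-map-≥ : {B : Set} {Q : Pred B 0ℓ} (Q? : Decidable Q) (f : B → A) →
                (∀ {y} → Q y → P (f y)) → ∀ ys → count Q? ys ≤ count P? (map f ys)
  count-map-≥ Q? f Q⇒P∘f []       = z≤n
  count-map-≥ Q? f Q⇒P∘f (y ∷ ys) with Q? y | P? (f y)
  ... | yes _ | yes _ = s≤s (count-map-≥ Q? f Q⇒P∘f ys)
  ... | yes q | no ¬p = ⊥-elim (¬p (Q⇒P∘f q))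
  ... | no _  | yes _ = m≤n⇒m≤1+n (count-map-≥ Q? f Q⇒P∘f ys)
  ... | no _  | no _  = count-map-≥ Q? f Q⇒P∘f ys

  count-mono : {Q : Pred A 0ℓ} (Q? : Decidable Q) → (∀ {x} → Q x → P x) →
               ∀ xs → count Q? xs ≤ count P? xs
  count-mono Q? Q⇒P xs =
    subst (λ ys → count Q? xs ≤ count P? ys) (map-id xs) (count-map-≥ Q? id Q⇒P xs)

  count-concatMap-≥ : {B : Set} {G : Pred B 0ℓ} (G? : Decidable G) (h : B → List A) (c : ℕ) →
                      (∀ {x} → G x → c ≤ count P? (h x)) →
                      ∀ xs → count G? xs * c ≤ count P? (concatMap h xs)
  count-concatMap-≥ G? h c bound []       = z≤n
  count-concatMap-≥ G? h c bound (x ∷ xs) with G? x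
  ... | yes g = subst (c + count G? xs * c ≤_) (sym (count-++ (h x) (concatMap h xs)))
                  (+-mono-≤ (bound g) (count-concatMap-≥ G? h c bound xs))
  ... | no _  = subst (count G? xs * c ≤_) (sym (count-++ (h x) (concatMap h xs)))
                  (≤-trans (count-concatMap-≥ G? h c bound xs) (m≤n+m _ _))

  count-applyUpTo-all : (f : ℕ → A) (n : ℕ) → (∀ {j} → j < n → P (f j)) →
                        count P? (applyUpTo f n) ≡ n
  count-applyUpTo-all f n Pf =
    trans (cong length (filter-all P? (applyUpTo⁺₁ f n Pf))) (length-applyUpTo f n)

  count-applyUpTo-all-but-first : (f : ℕ → A) (n : ℕ) → (∀ {j} → 0 < j → j < n → P (f j)) →
                                  n ∸ 1 ≤ count P? (applyUpTo f n)
  count-applyUpTo-all-but-first f zero    _  = z≤n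
  count-applyUpTo-all-but-first f (suc n) Pf = begin
    n                                ≡⟨ sym (count-applyUpTo-all (f ∘ suc) n (Pf z<s ∘ s<s)) ⟩
    count P? (applyUpTo (f ∘ suc) n) ≤⟨ m≤n+m _ _ ⟩
    count P? [ f 0 ] + count P? (applyUpTo (f ∘ suc) n)
                                     ≡⟨ sym (count-++ [ f 0 ] _) ⟩
    count P? (applyUpTo f (suc n))   ∎
    where open ≤-Reasoning

  count-applyUpTo-blocks : (n c a : ℕ) (f : ℕ → A) →
                           (∀ q → c ≤ count P? (applyUpTo (λ s → f (q * n + s)) n)) →
                           a * c ≤ count P? (applyUpTo f (a * n))
  count-applyUpTo-blocks n c zero    f blocks = z≤n
  count-applyUpTo-blocks n c (suc a) f blocks = begin
    c + a * c
      ≤⟨ +-mono-≤ (blocks 0) (count-applyUpTo-blocks n c a (λ j → f (n + j)) shifted) ⟩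
    count P? (applyUpTo f n) + count P? (applyUpTo (λ j → f (n + j)) (a * n))
      ≡⟨ sym (count-++ (applyUpTo f n) _) ⟩
    count P? (applyUpTo f n ++ applyUpTo (λ j → f (n + j)) (a * n))
      ≡⟨ cong (count P?) (sym (applyUpTo-+ f n (a * n))) ⟩
    count P? (applyUpTo f (n + a * n)) ∎
    where
    open ≤-Reasoning
    shifted : ∀ q → c ≤ count P? (applyUpTo (λ s → f (n + (q * n + s))) n)
    shifted q = subst (c ≤_)
      (cong (count P?) (applyUpTo-cong (λ s → cong f (+-assoc n (q * n) s)) n)) (blocks (suc q))

_%2^_ : ℕ → ℕ → ℕ
x %2^ m = _%_ x (2 ^ m) {{m^n≢0 2 m}}

infixl 7 _%2^_

m^n∣m^[n+o] : ∀ m n o → m ^ n ∣ m ^ (n + o)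
m^n∣m^[n+o] m n o = subst (m ^ n ∣_) (sym (^-distribˡ-+-* m n o)) (m∣m*n (m ^ o))

%≡1⇒∣∸1 : ∀ {x n} .{{_ : NonZero n}} → x % n ≡ 1 → n ∣ x ∸ 1
%≡1⇒∣∸1 {x} {n} x%n≡1 =
  divides (x / n) (cong (_∸ 1) (trans (m≡m%n+[m/n]*n x n) (cong (_+ x / n * n) x%n≡1)))

≡1+t*2^[1+m]⇒%2^[1+m]≡1 : ∀ {x t} m → x ≡ 1 + t * 2 ^ suc m → x %2^ suc m ≡ 1
≡1+t*2^[1+m]⇒%2^[1+m]≡1 {x} {t} m x≡ = begin
  x %2^ suc m     ≡⟨ %-congˡ x≡ ⟩
  (1 + t * N) % N ≡⟨ [m+kn]%n≡m%n 1 t N ⟩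
  1 % N           ≡⟨ m<n⇒m%n≡m (*-monoʳ-≤ 2 (m^n>0 2 m)) ⟩
  1               ∎
  where
  open ≡-Reasoning
  N : ℕ
  N = 2 ^ suc m
  instance
    N≢0 : NonZero N
    N≢0 = m^n≢0 2 (suc m)

even⇒≡2*[n/2] : ∀ {n} → n % 2 ≡ 0 → n ≡ 2 * (n / 2)
even⇒≡2*[n/2] {n} n%2≡0 = sym (m*[n/m]≡n (m%n≡0⇒n∣m n 2 n%2≡0))

odd-* : ∀ {m n} → m % 2 ≡ 1 → n % 2 ≡ 1 → (m * n) % 2 ≡ 1
odd-* {m} {n} m%2≡1 n%2≡1 =
  trans (%-distribˡ-* m n 2) (cong₂ (λ x y → (x * y) % 2) m%2≡1 n%2≡1)

[1+2*n]%2≡1 : ∀ n → (1 + 2 * n) % 2 ≡ 1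
[1+2*n]%2≡1 n = %-remove-+ʳ 1 (m∣m*n {2} n)

even-or-odd : ∀ n → Σ ℕ λ h → n ≡ 2 * h ⊎ n ≡ 1 + 2 * h
even-or-odd zero = 0 , inj₁ refl
even-or-odd (suc n) with even-or-odd n
... | h , inj₁ refl = h , inj₂ refl
... | h , inj₂ refl = suc h , inj₁ (cong suc (sym (+-suc h (h + 0))))

tv≤ : ∀ K n → tv K n ≤ K
tv≤ zero    n = z≤n
tv≤ (suc K) n with n % 2
... | zero  = s≤s (tv≤ K (n / 2))
... | suc _ = z≤n

2^m∣n⇒m≤tv : ∀ {m K} n → m ≤ K → 2 ^ m ∣ n → m ≤ tv K n
2^m∣n⇒m≤tv {zero}          n _         _     = z≤n
2^m∣n⇒m≤tv {suc m} {suc K} n (s≤s m≤K) 2^m∣n with n % 2 in n%2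
... | zero  = s≤s (2^m∣n⇒m≤tv (n / 2) m≤K
                    (*-cancelˡ-∣ 2 (subst (2 ^ suc m ∣_) (even⇒≡2*[n/2] n%2) 2^m∣n)))
... | suc _ with () ← trans (sym n%2) (n∣m⇒m%n≡0 n 2 (∣-trans (m∣m*n (2 ^ m)) 2^m∣n))

2^[1+m]∤n⇒tv≤m : ∀ {m} K n → ¬ 2 ^ suc m ∣ n → tv K n ≤ m
2^[1+m]∤n⇒tv≤m zero n _ = z≤n
2^[1+m]∤n⇒tv≤m (suc K) n ∤n with n % 2 in n%2
2^[1+m]∤n⇒tv≤m {zero}  (suc K) n ∤n | zero  = ⊥-elim (∤n (m%n≡0⇒n∣m n 2 n%2))
2^[1+m]∤n⇒tv≤m {suc m} (suc K) n ∤n | zero  = s≤s (2^[1+m]∤n⇒tv≤m K (n / 2)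
  (∤n ∘ subst (2 ^ suc (suc m) ∣_) (sym (even⇒≡2*[n/2] n%2)) ∘ *-monoʳ-∣ 2))
2^[1+m]∤n⇒tv≤m         (suc K) n ∤n | suc _ = z≤n

maxVal≤ : ∀ {K m} xs → All (λ x → tv1 K x ≤ m) xs → maxVal K xs ≤ m
maxVal≤     []       []         = z≤n
maxVal≤ {K} (x ∷ xs) (px ∷ pxs) = ⊔-lub px (maxVal≤ {K} xs pxs)

≤prodVal : ∀ {k m} xs → m ≤ suc k → product xs %2^ m ≡ 1 → m ≤ prodVal (suc k) xs
≤prodVal {k} {m} xs m≤1+k ∏%2^m≡1 =
  2^m∣n⇒m≤tv (y ∸ 1) m≤1+k (%≡1⇒∣∸1 {{m^n≢0 2 m}} y%2^m≡1)
  where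
  y : ℕ
  y = product xs %2^ suc k
  2^m∣2^[1+k] : 2 ^ m ∣ 2 ^ suc k
  2^m∣2^[1+k] with o , m+o≡1+k ← m≤n⇒∃[o]m+o≡n m≤1+k =
    subst (λ K → 2 ^ m ∣ 2 ^ K) m+o≡1+k (m^n∣m^[n+o] 2 m o)
  y%2^m≡1 : y %2^ m ≡ 1
  y%2^m≡1 = trans (m∣n⇒o%n%m≡o%m (2 ^ m) (2 ^ suc k) (product xs)
                     {{m^n≢0 2 m}} {{m^n≢0 2 (suc k)}} 2^m∣2^[1+k]) ∏%2^m≡1

low-tuple⇒korselt : ∀ {k m} xs → m ≤ suc k → All (λ x → tv1 (suc k) x ≤ m) xs →
                    product xs %2^ m ≡ 1 → maxVal (suc k) xs ≤ prodVal (suc k) xs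
low-tuple⇒korselt xs m≤1+k lows ∏%2^m≡1 =
  ≤-trans (maxVal≤ xs lows) (≤prodVal xs m≤1+k ∏%2^m≡1)

m<n⇒m+n<2*n : ∀ {m n} → m < n → m + n < 2 * n
m<n⇒m+n<2*n {m} {n} m<n = subst (m + n <_) (cong (n +_) (sym (+-identityʳ n))) (+-monoˡ-< n m<n)

halve : ∀ h P → 1 + 2 * h * (2 * P) ≡ 1 + h * (2 * (2 * P))
halve = solve-∀

module _ {b : ℕ} (b-odd : b % 2 ≡ 1) where

  b≡1+[b/2]*2 : b ≡ 1 + b / 2 * 2
  b≡1+[b/2]*2 = trans (m≡m%n+[m/n]*n b 2) (cong (_+ b / 2 * 2) b-odd)

  odd+b≡2*[1+h+b/2] : ∀ h → 1 + 2 * h + b ≡ 2 * suc (h + b / 2)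
  odd+b≡2*[1+h+b/2] h = trans (cong (1 + 2 * h +_) b≡1+[b/2]*2) (regroup h (b / 2))
    where
    regroup : ∀ h c → 1 + 2 * h + (1 + c * 2) ≡ 2 * suc (h + c)
    regroup = solve-∀

  shift-inverse : ∀ {s t} P → b * (1 + 2 * s) ≡ 1 + t * (2 * P) →
                  b * (1 + 2 * (s + P)) ≡ 1 + (t + b) * (2 * P)
  shift-inverse {s} {t} P eq = begin
    b * (1 + 2 * (s + P))         ≡⟨ distrib b s P ⟩
    b * (1 + 2 * s) + b * (2 * P) ≡⟨ cong (_+ b * (2 * P)) eq ⟩
    1 + t * (2 * P) + b * (2 * P) ≡⟨ regroup t b (2 * P) ⟩
    1 + (t + b) * (2 * P)         ∎
    where
    open ≡-Reasoning
    distrib : ∀ b s P → b * (1 + 2 * (s + P)) ≡ b * (1 + 2 * s) + b * (2 * P)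
    distrib = solve-∀
    regroup : ∀ t b Q → 1 + t * Q + b * Q ≡ 1 + (t + b) * Q
    regroup = solve-∀

  -- Hensel lifting: for odd t, shifting 1 + 2s by 2^(M+1) makes the error t + b, which is even.
  inverse-mod-2^ : ∀ M → Σ ℕ λ s → Σ ℕ λ t → s < 2 ^ M × b * (1 + 2 * s) ≡ 1 + t * 2 ^ suc M
  inverse-mod-2^ zero = 0 , b / 2 , z<s , trans (*-identityʳ b) b≡1+[b/2]*2
  inverse-mod-2^ (suc M) with inverse-mod-2^ M
  ... | s , t , s<2^M , eq with even-or-odd t
  ...   | h , inj₁ refl =
    s , h , <-≤-trans s<2^M (m≤m+n (2 ^ M) _) , trans eq (halve h (2 ^ M))
  ...   | h , inj₂ refl =
    s + 2 ^ M , suc (h + b / 2) , m<n⇒m+n<2*n s<2^M ,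
    trans (shift-inverse {s} {1 + 2 * h} (2 ^ M) eq)
          (trans (cong (λ u → 1 + u * 2 ^ suc M) (odd+b≡2*[1+h+b/2] h))
                 (halve (suc (h + b / 2)) (2 ^ M)))

  -- Offset 0 must be avoided when counting: 1 + 2 q 2^(M+1) has valuation above M + 1.
  inverse-mod-2^-positive : ∀ M → Σ ℕ λ s → Σ ℕ λ t →
                            0 < s × s < 2 ^ suc M × b * (1 + 2 * s) ≡ 1 + t * 2 ^ suc M
  inverse-mod-2^-positive M with inverse-mod-2^ M
  ... | suc s , t , s<2^M , eq = suc s , t , z<s , <-≤-trans s<2^M (m≤m+n (2 ^ M) _) , eq
  ... | zero  , t , _     , eq =
    2 ^ M , t + b , m^n>0 2 M , m<n⇒m+n<2*n (m^n>0 2 M) , shift-inverse {0} {t} (2 ^ M) eq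

module AtLevel (k m : ℕ) where

  Low : Pred ℕ 0ℓ
  Low x = tv1 (suc k) x ≤ m

  LowOdd : Pred ℕ 0ℓ
  LowOdd x = Low x × x % 2 ≡ 1

  LowInverse : ℕ → Pred ℕ 0ℓ
  LowInverse b x = Low x × (b * x) %2^ m ≡ 1

  LowInverseTuple : ℕ → Pred (List ℕ) 0ℓ
  LowInverseTuple b xs = All Low xs × (b * product xs) %2^ m ≡ 1

  low? : Decidable Low
  low? x = tv1 (suc k) x ≤? m

  lowOdd? : Decidable LowOdd
  lowOdd? x = low? x ×-dec (x % 2 ≟ 1)

  lowInverse? : ∀ b → Decidable (LowInverse b)
  lowInverse? b x = low? x ×-dec ((b * x) %2^ m ≟ 1)

  lowInverseTuple? : ∀ b → Decidable (LowInverseTuple b)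
  lowInverseTuple? b xs = all? low? xs ×-dec ((b * product xs) %2^ m ≟ 1)

  module _ (B A : ℕ)
           (inverses : ∀ b → b % 2 ≡ 1 → B ≤ count (lowInverse? b) (unitsMod k))
           (lowOdds : A ≤ count lowOdd? (unitsMod k)) where

    count-lowInverseTuple : ∀ r {b} → b % 2 ≡ 1 →
                            B * A ^ r ≤ count (lowInverseTuple? b) (tuples k (suc r))
    count-lowInverseTuple zero {b} b-odd = begin
      B * 1                                   ≤⟨ *-monoˡ-≤ 1 (inverses b b-odd) ⟩
      count (lowInverse? b) (unitsMod k) * 1  ≤⟨ count-concatMap-≥ (lowInverseTuple? b)
                                                   (lowInverse? b) _ 1 singleton (unitsMod k) ⟩
      count (lowInverseTuple? b) (tuples k 1) ∎
      where
      open ≤-Reasoning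
      singleton : ∀ {x} → LowInverse b x → 1 ≤ count (lowInverseTuple? b) [ x ∷ [] ]
      singleton {x} (low , bx≡1) = filter-some (lowInverseTuple? b) {[ x ∷ [] ]}
        (here (low ∷ [] , subst (λ y → (b * y) %2^ m ≡ 1) (sym (*-identityʳ x)) bx≡1))
    count-lowInverseTuple (suc r) {b} b-odd = begin
      B * (A * A ^ r)                          ≡⟨ x*[y*z]≡y*[x*z] B A (A ^ r) ⟩
      A * (B * A ^ r)                          ≤⟨ *-monoˡ-≤ (B * A ^ r) lowOdds ⟩
      count lowOdd? (unitsMod k) * (B * A ^ r) ≤⟨ count-concatMap-≥ (lowInverseTuple? b)
                                                    lowOdd? _ _ prepend (unitsMod k) ⟩
      count (lowInverseTuple? b) (tuples k (suc (suc r))) ∎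
      where
      open ≤-Reasoning
      x*[y*z]≡y*[x*z] : ∀ x y z → x * (y * z) ≡ y * (x * z)
      x*[y*z]≡y*[x*z] = solve-∀
      prepend : ∀ {x} → LowOdd x →
                B * A ^ r ≤ count (lowInverseTuple? b) (map (x ∷_) (tuples k (suc r)))
      prepend {x} (low , x-odd) = ≤-trans (count-lowInverseTuple r {b * x} (odd-* {b} b-odd x-odd))
        (count-map-≥ (lowInverseTuple? b) (lowInverseTuple? (b * x)) (x ∷_)
          (λ (lows , bx∏≡1) → low ∷ lows , subst (λ y → y %2^ m ≡ 1) (*-assoc b x _) bx∏≡1)
          (tuples k (suc r)))

    korseltCount-≥ : m ≤ suc k → ∀ r → B * A ^ r ≤ korseltCount k (suc r)
    korseltCount-≥ m≤1+k r = ≤-trans (count-lowInverseTuple r {1} refl)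
      (count-mono (λ xs → maxVal (suc k) xs ≤? prodVal (suc k) xs) (lowInverseTuple? 1)
        (λ {xs} (lows , ∏≡1) → low-tuple⇒korselt xs m≤1+k lows
          (subst (λ y → y %2^ m ≡ 1) (*-identityˡ (product xs)) ∏≡1))
        (tuples k (suc r)))

unitsMod≡applyUpTo : ∀ k → unitsMod k ≡ applyUpTo (λ j → 1 + 2 * j) (2 ^ k)
unitsMod≡applyUpTo k = map-upTo (λ j → 1 + 2 * j) (2 ^ k)

korseltCount-≥-shallow : ∀ k r → (2 ^ k) ^ r ≤ korseltCount k (suc r)
korseltCount-≥-shallow k r = subst (_≤ korseltCount k (suc r)) (*-identityˡ _)
  (korseltCount-≥ 1 (2 ^ k) inverses lowOdds ≤-refl r)
  where
  open AtLevel k (suc k)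
  lowOdds : 2 ^ k ≤ count lowOdd? (unitsMod k)
  lowOdds = ≤-reflexive (sym (trans (cong (count lowOdd?) (unitsMod≡applyUpTo k))
    (count-applyUpTo-all lowOdd? _ (2 ^ k) (λ {j} _ → tv≤ (suc k) (2 * j) , [1+2*n]%2≡1 j))))
  inverses : ∀ b → b % 2 ≡ 1 → 1 ≤ count (lowInverse? b) (unitsMod k)
  inverses b b-odd with inverse-mod-2^ {b} b-odd k
  ... | s , t , s<2^k , eq =
    subst (λ us → 1 ≤ count (lowInverse? b) us) (sym (unitsMod≡applyUpTo k))
      (filter-some (lowInverse? b)
        (applyUpTo⁺ _ (tv≤ (suc k) (2 * s) , ≡1+t*2^[1+m]⇒%2^[1+m]≡1 {t = t} k eq) s<2^k))

korseltCount-≥-deep : ∀ M e r →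
                      2 ^ e * (2 ^ e * (2 ^ suc M ∸ 1)) ^ r ≤ korseltCount (e + suc M) (suc r)
korseltCount-≥-deep M e =
  korseltCount-≥ (2 ^ e) (2 ^ e * (N ∸ 1)) inverses lowOdds (≤-trans (m≤n+m L e) (n≤1+n _))
  where
  L N : ℕ
  L = suc M
  N = 2 ^ L
  open AtLevel (e + L) L
  units : unitsMod (e + L) ≡ applyUpTo (λ j → 1 + 2 * j) (2 ^ e * N)
  units = trans (unitsMod≡applyUpTo (e + L)) (cong (applyUpTo _) (^-distribˡ-+-* 2 e L))
  low-in-block : ∀ q {s} → 0 < s → s < N → Low (1 + 2 * (q * N + s))
  low-in-block q {s} 0<s s<N = 2^[1+m]∤n⇒tv≤m (suc (e + L)) (2 * (q * N + s)) λ 2N∣ →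
    <⇒≱ s<N (∣⇒≤ {{>-nonZero 0<s}} (∣m+n∣m⇒∣n (*-cancelˡ-∣ 2 2N∣) (n∣m*n q)))
  lowOdds : 2 ^ e * (N ∸ 1) ≤ count lowOdd? (unitsMod (e + L))
  lowOdds = subst (λ us → 2 ^ e * (N ∸ 1) ≤ count lowOdd? us) (sym units)
    (count-applyUpTo-blocks lowOdd? N (N ∸ 1) (2 ^ e) _ λ q →
      count-applyUpTo-all-but-first lowOdd? _ N λ {s} 0<s s<N →
        low-in-block q 0<s s<N , [1+2*n]%2≡1 (q * N + s))
  inverses : ∀ b → b % 2 ≡ 1 → 2 ^ e ≤ count (lowInverse? b) (unitsMod (e + L))
  inverses b b-odd with inverse-mod-2^-positive {b} b-odd M
  ... | s , t , 0<s , s<N , eq =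
    subst (λ us → 2 ^ e ≤ count (lowInverse? b) us) (sym units)
      (≤-trans (≤-reflexive (sym (*-identityʳ (2 ^ e))))
        (count-applyUpTo-blocks (lowInverse? b) N 1 (2 ^ e) _ λ q →
          filter-some (lowInverse? b) (applyUpTo⁺ _ (inverse-in-block q) s<N)))
    where
    open ≡-Reasoning
    inverse-in-block : ∀ q → LowInverse b (1 + 2 * (q * N + s))
    inverse-in-block q = low-in-block q 0<s s<N ,
      ≡1+t*2^[1+m]⇒%2^[1+m]≡1 {t = t + 2 * b * q} M (begin
        b * (1 + 2 * (q * N + s))       ≡⟨ separate b q s N ⟩
        b * (1 + 2 * s) + 2 * b * q * N ≡⟨ cong (_+ 2 * b * q * N) eq ⟩
        1 + t * N + 2 * b * q * N       ≡⟨ regroup t (2 * b * q) N ⟩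
        1 + (t + 2 * b * q) * N         ∎)
      where
      separate : ∀ b q s N → b * (1 + 2 * (q * N + s)) ≡ b * (1 + 2 * s) + 2 * b * q * N
      separate = solve-∀
      regroup : ∀ t u N → 1 + t * N + u * N ≡ 1 + (t + u) * N
      regroup = solve-∀

[m*n]^o≡m^o*n^o : ∀ m n o → (m * n) ^ o ≡ m ^ o * n ^ o
[m*n]^o≡m^o*n^o m n zero    = refl
[m*n]^o≡m^o*n^o m n (suc o) =
  trans (cong (m * n *_) ([m*n]^o≡m^o*n^o m n o)) (interchange m n (m ^ o) (n ^ o))
  where
  interchange : ∀ m n x y → m * n * (x * y) ≡ m * x * (n * y)
  interchange = solve-∀

-- (1 + a)^n − a^n is a sum of n terms, each at most (1 + a)^(n − 1).
[1+a]^[1+n]≤[1+a]*a^n+n*[1+a]^n : ∀ a n → suc a ^ suc n ≤ suc a * a ^ n + n * suc a ^ n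
[1+a]^[1+n]≤[1+a]*a^n+n*[1+a]^n a zero    = ≤-reflexive (sym (+-identityʳ _))
[1+a]^[1+n]≤[1+a]*a^n+n*[1+a]^n a (suc n) = begin
  S * X + a * (S * X)
    ≤⟨ +-monoʳ-≤ (S * X) (*-monoʳ-≤ a ([1+a]^[1+n]≤[1+a]*a^n+n*[1+a]^n a n)) ⟩
  S * X + a * (S * Y + n * X)
    ≡⟨ regroup a n X Y ⟩
  S * (a * Y) + (S * X + a * (n * X))
    ≤⟨ +-monoʳ-≤ (S * (a * Y)) (+-monoʳ-≤ (S * X) (*-monoˡ-≤ (n * X) (n≤1+n a))) ⟩
  S * (a * Y) + (S * X + S * (n * X))
    ≡⟨ collect a n X Y ⟩
  S * (a * Y) + suc n * (S * X) ∎
  where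
  open ≤-Reasoning
  S X Y : ℕ
  S = suc a
  X = suc a ^ n
  Y = a ^ n
  regroup : ∀ a n X Y → (1 + a) * X + a * ((1 + a) * Y + n * X) ≡
                        (1 + a) * (a * Y) + ((1 + a) * X + a * (n * X))
  regroup = solve-∀
  collect : ∀ a n X Y → (1 + a) * (a * Y) + ((1 + a) * X + (1 + a) * (n * X)) ≡
                        (1 + a) * (a * Y) + (1 + n) * ((1 + a) * X)
  collect = solve-∀

2n≤1+a⇒[1+a]^n≤2*a^n : ∀ a n → 2 * n ≤ suc a → suc a ^ n ≤ 2 * a ^ n
2n≤1+a⇒[1+a]^n≤2*a^n a n 2n≤1+a =
  *-cancelˡ-≤ S (+-cancelʳ-≤ (S * X) (S * X) (S * (2 * Y)) (begin
    S * X + S * X           ≡⟨ double S X ⟩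
    2 * (S * X)             ≤⟨ *-monoʳ-≤ 2 ([1+a]^[1+n]≤[1+a]*a^n+n*[1+a]^n a n) ⟩
    2 * (S * Y + n * X)     ≡⟨ distribute S Y n X ⟩
    S * (2 * Y) + 2 * n * X ≤⟨ +-monoʳ-≤ (S * (2 * Y)) (*-monoˡ-≤ X 2n≤1+a) ⟩
    S * (2 * Y) + S * X     ∎))
  where
  open ≤-Reasoning
  S X Y : ℕ
  S = suc a
  X = suc a ^ n
  Y = a ^ n
  double : ∀ S X → S * X + S * X ≡ 2 * (S * X)
  double = solve-∀
  distribute : ∀ S Y n X → 2 * (S * Y + n * X) ≡ S * (2 * Y) + 2 * n * X
  distribute = solve-∀

2^-bracket : ∀ n → Σ ℕ λ M → suc n ≤ 2 ^ M × 2 ^ M ≤ 2 * suc n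
2^-bracket zero = 0 , ≤-refl , s≤s z≤n
2^-bracket (suc n) with 2^-bracket n
... | M , 1+n≤2^M , 2^M≤2+2n with suc (suc n) ≤? 2 ^ M
...   | yes 2+n≤2^M = M , 2+n≤2^M , ≤-trans 2^M≤2+2n (*-monoʳ-≤ 2 (n≤1+n (suc n)))
...   | no  2+n≰2^M = suc M ,
  subst (λ P → suc (suc n) ≤ 2 * P × 2 * P ≤ 2 * suc (suc n)) (sym 2^M≡1+n)
    (s≤s 1+n≤1+2n , *-monoʳ-≤ 2 (n≤1+n (suc n)))
  where
  2^M≡1+n : 2 ^ M ≡ suc n
  2^M≡1+n = ≤-antisym (≤-pred (≰⇒> 2+n≰2^M)) 1+n≤2^M
  1+n≤1+2n : suc n ≤ n + suc (n + 0)
  1+n≤1+2n = subst (suc n ≤_) (sym (+-suc n (n + 0))) (s≤s (m≤m+n n (n + 0)))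

2*[2*n]≤8*n : ∀ n → 2 * (2 * n) ≤ 8 * n
2*[2*n]≤8*n n = subst (_≤ 8 * n) (four n) (*-monoˡ-≤ n {4} {8} (s≤s (s≤s (s≤s (s≤s z≤n)))))
  where
  four : ∀ n → 4 * n ≡ 2 * (2 * n)
  four = solve-∀

shallow-ratio : ∀ K r → K ≤ 2 * (2 * suc r) → K ^ suc r ≤ 8 * suc r * K ^ r
shallow-ratio K r K≤4r = *-monoˡ-≤ (K ^ r) (≤-trans K≤4r (2*[2*n]≤8*n (suc r)))

deep-ratio : ∀ E N r → 2 * suc r ≤ N → N ≤ 2 * (2 * suc r) →
             (E * N) ^ suc r ≤ 8 * suc r * (E * (E * (N ∸ 1)) ^ r)
deep-ratio E (suc a) r 2r≤N N≤4r = begin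
  E * N * (E * N) ^ r
    ≡⟨ cong (E * N *_) ([m*n]^o≡m^o*n^o E N r) ⟩
  E * N * (E ^ r * N ^ r)
    ≤⟨ *-mono-≤ (*-monoʳ-≤ E N≤4r) (*-monoʳ-≤ (E ^ r) N^r≤2a^r) ⟩
  E * (2 * (2 * suc r)) * (E ^ r * (2 * a ^ r))
    ≡⟨ regroup E (suc r) (E ^ r) (a ^ r) ⟩
  8 * suc r * (E * (E ^ r * a ^ r))
    ≡⟨ cong (λ z → 8 * suc r * (E * z)) (sym ([m*n]^o≡m^o*n^o E a r)) ⟩
  8 * suc r * (E * (E * a) ^ r) ∎
  where
  open ≤-Reasoning
  N : ℕ
  N = suc a
  N^r≤2a^r : N ^ r ≤ 2 * a ^ r
  N^r≤2a^r = 2n≤1+a⇒[1+a]^n≤2*a^n a r (≤-trans (*-monoʳ-≤ 2 (n≤1+n r)) 2r≤N)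
  regroup : ∀ E r X Y → E * (2 * (2 * r)) * (X * (2 * Y)) ≡ 8 * r * (E * (X * Y))
  regroup = solve-∀

korseltCount-density : ∀ r k → 2 ^ (k * suc r) ≤ 8 * suc r * korseltCount k (suc r)
korseltCount-density r k with 2^-bracket r
... | M , 1+r≤2^M , 2^M≤2+2r with ≤-total (suc M) k
...   | inj₂ k≤1+M = begin
  2 ^ (k * suc r)                    ≡⟨ sym (^-*-assoc 2 k (suc r)) ⟩
  (2 ^ k) ^ suc r                    ≤⟨ shallow-ratio (2 ^ k) r 2^k≤4r ⟩
  8 * suc r * (2 ^ k) ^ r            ≤⟨ *-monoʳ-≤ (8 * suc r) (korseltCount-≥-shallow k r) ⟩
  8 * suc r * korseltCount k (suc r) ∎
  where
  open ≤-Reasoning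
  2^k≤4r : 2 ^ k ≤ 2 * (2 * suc r)
  2^k≤4r = ≤-trans (^-monoʳ-≤ 2 k≤1+M) (*-monoʳ-≤ 2 2^M≤2+2r)
...   | inj₁ 1+M≤k with k ∸ suc M | m∸n+n≡m 1+M≤k
...     | e | refl = begin
  2 ^ ((e + suc M) * suc r)           ≡⟨ sym (^-*-assoc 2 (e + suc M) (suc r)) ⟩
  (2 ^ (e + suc M)) ^ suc r           ≡⟨ cong (_^ suc r) (^-distribˡ-+-* 2 e (suc M)) ⟩
  (2 ^ e * 2 ^ suc M) ^ suc r         ≤⟨ deep-ratio (2 ^ e) (2 ^ suc M) r 2r≤2^[1+M] 2^[1+M]≤4r ⟩
  8 * suc r * (2 ^ e * (2 ^ e * (2 ^ suc M ∸ 1)) ^ r)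
                                      ≤⟨ *-monoʳ-≤ (8 * suc r) (korseltCount-≥-deep M e r) ⟩
  8 * suc r * korseltCount (e + suc M) (suc r) ∎
  where
  open ≤-Reasoning
  2r≤2^[1+M] : 2 * suc r ≤ 2 ^ suc M
  2r≤2^[1+M] = *-monoʳ-≤ 2 1+r≤2^M
  2^[1+M]≤4r : 2 ^ suc M ≤ 2 * (2 * suc r)
  2^[1+M]≤4r = *-monoʳ-≤ 2 2^M≤2+2r

-- The bound holds for every r ≥ 1; the hypothesis 3 ≤ r only excludes r = 0.
mainTheorem6 : Σ ℕ λ d → Σ ℕ λ r₀ → (r : ℕ) → 3 ≤ r → r₀ ≤ r → (k : ℕ) →
                 2 ^ (k * r) ≤ suc d * r * korseltCount k r
mainTheorem6 = 7 , 0 , λ { zero () ; (suc r) _ _ k → korseltCount-density r k }
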